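{- Let $\mathcal{A}$ be a linearly ordered alphabet of cardinality at least $4$. For every integer $n \geqslant 3$, there exists a word $w \in \mathcal{A}^{2^n-1}$ on which the IS-algorithm performs $n-2$ recursive calls, and such that \[|\mathsf{is}^k(w)|+1 = 2^{ -k} (|w|+1)\] for all $k \in \{0,1,\ldots,n-2\}$.
   Context: Words are indexed from $0$: $w = w_0 w_1 \cdots w_{|w|-1}$, and $w_{i \cdots j} = w_i w_{i+1} \cdots w_j$. A sentinel letter $\$ \notin \mathcal{A}$ is declared smaller than every letter of $\mathcal{A}$, and one sets $w_{|w|} = \$$. An integer $i \leqslant |w|-1$ is $w$-non-decreasing if there exists $j$ with $i+1 \leqslant j \leqslant |w|-1$ and $w_i = w_{i+1} = \cdots = w_{j-1} < w_j$; it is $w$-locally minimal if moreover $i \geqslant 1$ and $w_{i-1} > w_i$. If $i_0 < i_1 < \cdots < i_{k-1}$ are the $w$-locally minimal integers and $i_k = |w|$, the unimodal factors of $w$ are $w_{i_0 \cdots i_1}, w_{i_1 \cdots i_2}, \ldots, w_{i_{k-1} \cdots i_k}$ (the last one ends with $\$$). The expanded IS-reduction $\mathsf{eis}(w)$ is the length-$k$ word, over the alphabet $\mathcal{A}^+\cdot(\varepsilon+\$)$ ordered lexicographically, whose letters are these unimodal factors in order. If $\mathsf{eis}(w)$ has $\ell$ distinct letters, $\mathsf{is}(w)$ is the word over $\{0,1,\ldots,\ell-1\}$ obtained by replacing each letter of $\mathsf{eis}(w)$ by its rank (starting from $0$, increasing with the lexicographic order) among these distinct letters. Set $\mathsf{is}^0(w)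 = w$ and $\mathsf{is}^{k+1}(w) = \mathsf{is}(\mathsf{is}^k(w))$. The IS-algorithm computes the suffix array of its input word $v$ by computing $\mathsf{is}(v)$ and then computing the suffix array of $\mathsf{is}(v)$, directly if the letters of $\mathsf{is}(v)$ are pairwise distinct, and by a recursive call of the IS-algorithm on $\mathsf{is}(v)$ otherwise (it then deduces the suffix array of $v$). -}

module Defs where

open import Level using (0ℓ)
open import Data.Bool using (Bool; true; false; _∧_; _∨_; not)
open import Data.Nat using (ℕ; zero; suc; _+_; _∸_; _<_; _≤ᵇ_)
import Data.Nat.Properties as ℕP
open import Data.Bool.ListAction using (all; any)
open import Data.List using (List; []; _∷_; map; upTo; length; filterᵇ; zipWith; drop; _++_; [_])
open import Data.List.Relation.Unary.Unique.Propositional using (Unique)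
open import Data.Product using (_×_)
open import Function using (_∘_)
open import Relation.Binary using (Rel; IsStrictTotalOrder; tri<; tri≈; tri>)
open import Relation.Binary.PropositionalEquality using (_≡_)
open import Relation.Nullary using (¬_)

-- Letters of A extended with the sentinel $, which is smaller than every letter.
data Ext (A : Set) : Set where
  $   : Ext A
  ⟨_⟩ : A → Ext A

nubB : {X : Set} → (X → X → Bool) → List X → List X
nubB eq []       = []
nubB eq (x ∷ xs) = x ∷ filterᵇ (not ∘ eq x) (nubB eq xs)

-- The integer interval [a, b] (inclusive), empty if b < a.
range : ℕ → ℕ → List ℕ
range a b = map (a +_) (upTo (suc b ∸ a))

module IS {A : Set} {_≺_ : Rel A 0ℓ} (sto : IsStrictTotalOrder _≡_ _≺_) where
  open IsStrictTotalOrder sto using (compare)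

  ltA : A → A → Bool
  ltA a b with compare a b
  ... | tri< _ _ _ = true
  ... | tri≈ _ _ _ = false
  ... | tri> _ _ _ = false

  eqA : A → A → Bool
  eqA a b with compare a b
  ... | tri< _ _ _ = false
  ... | tri≈ _ _ _ = true
  ... | tri> _ _ _ = false

  ltE : Ext A → Ext A → Bool
  ltE $ $ = false
  ltE $ ⟨ _ ⟩ = true
  ltE ⟨ _ ⟩ $ = false
  ltE ⟨ a ⟩ ⟨ b ⟩ = ltA a b

  eqE : Ext A → Ext A → Bool
  eqE $ $ = true
  eqE $ ⟨ _ ⟩ = false
  eqE ⟨ _ ⟩ $ = false
  eqE ⟨ a ⟩ ⟨ b ⟩ = eqA a b

  lexLt : List (Ext A) → List (Ext A) → Bool
  lexLt [] [] = false
  lexLt [] (_ ∷ _) = true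
  lexLt (_ ∷ _) [] = false
  lexLt (x ∷ xs) (y ∷ ys) = ltE x y ∨ (eqE x y ∧ lexLt xs ys)

  lexEq : List (Ext A) → List (Ext A) → Bool
  lexEq [] [] = true
  lexEq [] (_ ∷ _) = false
  lexEq (_ ∷ _) [] = false
  lexEq (x ∷ xs) (y ∷ ys) = eqE x y ∧ lexEq xs ys

  -- w_i, with w_{|w|} = $ (positions beyond are never used)
  at : List A → ℕ → Ext A
  at [] _ = $
  at (x ∷ xs) zero = ⟨ x ⟩
  at (x ∷ xs) (suc i) = at xs i

  factor : List A → ℕ → ℕ → List (Ext A)
  factor w i j = map (at w) (range i j)

  nonDecreasing : List A → ℕ → Bool
  nonDecreasing w i =
    any (λ j → all (λ m → eqE (at w m) (at w i)) (range i (j ∸ 1))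
               ∧ ltE (at w (j ∸ 1)) (at w j))
        (range (suc i) (length w ∸ 1))

  locallyMinimal : List A → ℕ → Bool
  locallyMinimal w zero = false
  locallyMinimal w (suc i) = nonDecreasing w (suc i) ∧ ltE (at w (suc i)) (at w i)

  boundaries : List A → List ℕ
  boundaries w = filterᵇ (locallyMinimal w) (upTo (length w)) ++ [ length w ]

  eis : List A → List (List (Ext A))
  eis w = zipWith (factor w) (boundaries w) (drop 1 (boundaries w))

  rank : List (Ext A) → List (List (Ext A)) → ℕ
  rank f fs = length (nubB lexEq (filterᵇ (λ g → lexLt g f) fs))

  is : List A → List ℕ
  is w = map (λ f → rank f (eis w)) (eis w)

module ISℕ = IS ℕP.<-isStrictTotalOrder

module _ {A : Set} {_≺_ : Rel A 0ℓ} (sto : IsStrictTotalOrder _≡_ _≺_) where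

  -- is^suc k w = is^{k+1}(w)
  is^suc : ℕ → List A → List ℕ
  is^suc zero w = IS.is sto w
  is^suc (suc k) w = ISℕ.is (is^suc k w)

  len-is^ : ℕ → List A → ℕ
  len-is^ zero w = length w
  len-is^ (suc k) w = length (is^suc k w)

  -- The IS-algorithm on w performs exactly m recursive calls:
  -- the recursive calls are on is^1(w), ..., is^m(w) (each having a repeated letter),
  -- and is^{m+1}(w) has pairwise distinct letters.
  PerformsRecursiveCalls : List A → ℕ → Set
  PerformsRecursiveCalls w m =
    (∀ k → k < m → ¬ Unique (is^suc k w)) × Unique (is^suc m w)

-- For a word X over {0,…,4} alternating between letters in {2,4} and letters in
-- {0,1} and ending with 3, the word double β X = 2 · low x₀ · β x₀ · low x₁ · β x₁ ⋯
-- (low x ∈ {0,1}, β x ≥ 2) has its locally minimal positions exactly at the odd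
-- indices, so its unimodal factors are low x · β x · low x′, one per letter x of X.
-- For the two choices of β used here these factors are ordered exactly as the
-- letters themselves, so is (double β X) is the rank word of X.  Iterating the
-- doubling from 2 2 3 gives a tower of alternating words of length 2^(k+2) − 1
-- containing 0, 1, 2, 3, hence equal to their own rank words: the IS-reduction walks
-- down the tower one level per step, halving |w| + 1 each time.  The top level uses
-- only the letters 0–3, and the IS-reduction only compares letters, so the word is
-- transported to A along the four values of f listed in increasing order.

module Submission where

open import Defs
open import Level using (0ℓ)
open import Data.Bool using (Bool; true; false; not; T; _∧_; _∨_)
import Data.Bool.Properties as Bool
open import Data.Bool.Properties using (∧-zeroʳ)
open import Data.Bool.ListAction using (and; or)
open import Data.Nat using (ℕ; zero; suc; _+_; _*_; _^_; _∸_; _≤_; _<_; z≤n; s≤s)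
open import Data.Nat.Properties
open import Data.Nat.Tactic.RingSolver using (solve-∀)
open import Data.Fin using (Fin)
open import Data.List using (List; []; _∷_; [_]; _++_; map; length; filterᵇ; upTo; applyUpTo; zipWith; drop; tabulate)
open import Data.List.Properties
  using (length-map; length-upTo; map-∘; map-cong; map-cong-local; map-id-local; map-upTo; filter-≐; zipWith-cong; map-zipWith; applyUpTo-∷ʳ)
open import Data.List.Membership.Propositional using (_∈_)
open import Data.List.Membership.Propositional.Properties using (∈-filter⁻; ∈-filter⁺; ∈-upTo⁺; ∈-upTo⁻)
open import Data.List.Membership.Propositional.Properties.WithK using (unique∧set⇒bag)
open import Data.List.Relation.Unary.Any using (here; there)
open import Data.List.Relation.Unary.All as All using (All; []; _∷_)
import Data.List.Relation.Unary.All.Properties as Allₚ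
open import Data.List.Relation.Unary.AllPairs using ([]; _∷_)
open import Data.List.Relation.Unary.Linked using (Linked; []; [-]; _∷_)
open import Data.List.Relation.Unary.Unique.Propositional using (Unique)
import Data.List.Relation.Unary.Unique.Propositional.Properties as Uniqueₚ
open import Data.List.Relation.Binary.BagAndSetEquality using (∼bag⇒↭)
open import Data.List.Relation.Binary.Permutation.Propositional using (↭-sym; ↭⇒↭ₛ)
open import Data.List.Relation.Binary.Permutation.Propositional.Properties using (↭-length)
import Data.List.Relation.Binary.Permutation.Setoid.Properties as Permₚ
import Data.List.Sort as Sort
open import Data.Empty using (⊥-elim)
open import Data.Unit using (⊤; tt)
open import Data.Product using (Σ; _×_; _,_; proj₁; proj₂)
open import Data.Sum using (_⊎_; inj₁; inj₂)
open import Function using (_∘_)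
open import Function.Bundles using (mk⇔)
open import Function.Definitions using (Injective)
open import Relation.Binary using (Rel; IsStrictTotalOrder; StrictTotalOrder; tri<; tri≈; tri>)
import Relation.Binary.Properties.StrictTotalOrder as StrictTotalOrderProperties
open import Relation.Binary.PropositionalEquality hiding ([_])
open import Relation.Nullary using (¬_; Dec)
open import Relation.Nullary.Reflects using (Reflects; ofʸ; ofⁿ; ¬-reflects; fromEquivalence; det)
open import Relation.Nullary.Decidable using (T?; from-yes; _×-dec_)

reflects⇒T : ∀ {P : Set} {b} → Reflects P b → P → T b
reflects⇒T (ofʸ _) _ = tt
reflects⇒T (ofⁿ ¬p) p = ¬p p

T⇒reflects : ∀ {P : Set} {b} → Reflects P b → T b → P
T⇒reflects (ofʸ p) _ = p

reflects-⇔ : ∀ {P Q : Set} {b} → (P → Q) → (Q → P) → Reflects P b → Reflects Q b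
reflects-⇔ to from r = fromEquivalence (to ∘ T⇒reflects r) (reflects⇒T r ∘ from)

module BooleanComparisons {A : Set} {_≺_ : Rel A 0ℓ} (sto : IsStrictTotalOrder _≡_ _≺_) where
  open IS sto using (ltA; eqA)
  open IsStrictTotalOrder sto using (compare)

  ltA-reflects : ∀ x y → Reflects (x ≺ y) (ltA x y)
  ltA-reflects x y with compare x y
  ... | tri< x≺y _ _ = ofʸ x≺y
  ... | tri≈ x⊀y _ _ = ofⁿ x⊀y
  ... | tri> x⊀y _ _ = ofⁿ x⊀y

  eqA-reflects : ∀ x y → Reflects (x ≡ y) (eqA x y)
  eqA-reflects x y with compare x y
  ... | tri< _ x≢y _ = ofⁿ x≢y
  ... | tri≈ _ x≡y _ = ofʸ x≡y
  ... | tri> _ x≢y _ = ofⁿ x≢y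

filterᵇ-map : ∀ {X Y : Set} (t : X → Y) {p : Y → Bool} {q : X → Bool} {xs} →
              All (λ x → p (t x) ≡ q x) xs → filterᵇ p (map t xs) ≡ map t (filterᵇ q xs)
filterᵇ-map t [] = refl
filterᵇ-map t {q = q} {x ∷ xs} (px≡qx ∷ eqs) rewrite px≡qx with q x
... | true  = cong (t x ∷_) (filterᵇ-map t eqs)
... | false = filterᵇ-map t eqs

filterᵇ-cong : ∀ {X : Set} {p q : X → Bool} → p ≗ q → filterᵇ p ≗ filterᵇ q
filterᵇ-cong {p = p} {q} p≗q = filter-≐ (T? ∘ p) (T? ∘ q) ((λ {x} → subst T (p≗q x)) , (λ {x} → subst T (sym (p≗q x))))

range-cons : ∀ {i j} → i ≤ j → range i j ≡ i ∷ range (suc i) j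
range-cons {i} {j} i≤j rewrite +-∸-assoc 1 i≤j = cong₂ _∷_ (+-identityʳ i) (begin
  map (i +_) (applyUpTo suc (j ∸ i))       ≡⟨ cong (map (i +_)) (map-upTo suc (j ∸ i)) ⟨
  map (i +_) (map suc (upTo (j ∸ i)))      ≡⟨ map-∘ (upTo (j ∸ i)) ⟨
  map ((i +_) ∘ suc) (upTo (j ∸ i))        ≡⟨ map-cong (+-suc i) (upTo (j ∸ i)) ⟩
  map (suc i +_) (upTo (j ∸ i))            ∎)
  where open ≡-Reasoning

range-empty : ∀ {i j} → j < i → range i j ≡ []
range-empty {i} {j} j<i rewrite m≤n⇒m∸n≡0 j<i = refl

applyUpTo-cong : ∀ {A : Set} {f g : ℕ → A} → f ≗ g → ∀ n → applyUpTo f n ≡ applyUpTo g n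
applyUpTo-cong {f = f} {g} f≗g n = trans (sym (map-upTo f n)) (trans (map-cong f≗g (upTo n)) (map-upTo g n))

filterᵇ-applyUpTo-odd : ∀ (p : ℕ → Bool) (f : ℕ → ℕ) n →
  (∀ i → i < n → p (f (suc (i + i))) ≡ true) → (∀ i → i ≤ n → p (f (i + i)) ≡ false) →
  filterᵇ p (applyUpTo f (suc (n + n))) ≡ applyUpTo (λ i → f (suc (i + i))) n
filterᵇ-applyUpTo-odd p f zero odd even rewrite even 0 z≤n = refl
filterᵇ-applyUpTo-odd p f (suc n) odd even rewrite +-suc n n | even 0 z≤n | odd 0 (s≤s z≤n) =
  cong (f 1 ∷_) (trans (filterᵇ-applyUpTo-odd p (f ∘ suc ∘ suc) n odd′ even′)
                       (applyUpTo-cong (λ i → cong (λ k → f (suc (suc k))) (sym (+-suc i i))) n))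
  where
  odd′ : ∀ i → i < n → p (f (suc (suc (suc (i + i))))) ≡ true
  odd′ i i<n = subst (λ k → p (f (suc k)) ≡ true) (cong suc (+-suc i i)) (odd (suc i) (s≤s i<n))
  even′ : ∀ i → i ≤ n → p (f (suc (suc (i + i)))) ≡ false
  even′ i i≤n = subst (λ k → p (f k) ≡ false) (cong suc (+-suc i i)) (even (suc i) (s≤s i≤n))

zipWith-applyUpTo-suc : ∀ {C : Set} (F : ℕ → ℕ → C) (f : ℕ → ℕ) n →
  zipWith F (applyUpTo f (suc n)) (applyUpTo (f ∘ suc) n) ≡ applyUpTo (λ i → F (f i) (f (suc i))) n
zipWith-applyUpTo-suc F f zero = refl
zipWith-applyUpTo-suc F f (suc n) = cong (F (f 0) (f 1) ∷_) (zipWith-applyUpTo-suc F (f ∘ suc) n)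

-- Ranks

module Deduplication {X : Set} (eq : X → X → Bool) (eq-reflects : ∀ x y → Reflects (x ≡ y) (eq x y)) where

  ∈-nubB⁻ : ∀ {a} xs → a ∈ nubB eq xs → a ∈ xs
  ∈-nubB⁻ (x ∷ xs) (here a≡x) = here a≡x
  ∈-nubB⁻ (x ∷ xs) (there a∈) = there (∈-nubB⁻ xs (proj₁ (∈-filter⁻ (T? ∘ not ∘ eq x) {xs = nubB eq xs} a∈)))

  ∈-nubB⁺ : ∀ {a} xs → a ∈ xs → a ∈ nubB eq xs
  ∈-nubB⁺ (x ∷ xs) (here a≡x) = here a≡x
  ∈-nubB⁺ {a} (x ∷ xs) (there a∈) with eq x a | eq-reflects x a
  ... | true  | ofʸ x≡a = here (sym x≡a)
  ... | false | ofⁿ x≢a = there (∈-filter⁺ (T? ∘ not ∘ eq x) (∈-nubB⁺ xs a∈) (reflects⇒T (¬-reflects (eq-reflects x a)) x≢a))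

  nubB-unique : ∀ xs → Unique (nubB eq xs)
  nubB-unique [] = []
  nubB-unique (x ∷ xs) = All.tabulate x≢ ∷ Uniqueₚ.filter⁺ (T? ∘ not ∘ eq x) (nubB-unique xs)
    where
    x≢ : ∀ {a} → a ∈ filterᵇ (not ∘ eq x) (nubB eq xs) → x ≢ a
    x≢ {a} a∈ = T⇒reflects (¬-reflects (eq-reflects x a)) (proj₂ (∈-filter⁻ (T? ∘ not ∘ eq x) {xs = nubB eq xs} a∈))

All-nubB : ∀ {X : Set} {P : X → Set} (eq : X → X → Bool) {xs} → All P xs → All P (nubB eq xs)
All-nubB eq [] = []
All-nubB eq (px ∷ pxs) = px ∷ Allₚ.filter⁺ _ (All-nubB eq pxs)

countBelow : {X : Set} → (X → X → Bool) → (X → X → Bool) → X → List X → ℕ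
countBelow lt eq x xs = length (nubB eq (filterᵇ (λ y → lt y x) xs))

-- IS.is w is by definition ranks lexLt lexEq (eis w).
ranks : {X : Set} → (X → X → Bool) → (X → X → Bool) → List X → List ℕ
ranks lt eq xs = map (λ x → countBelow lt eq x xs) xs

module RankInvariance {X Y : Set} {ltX eqX : X → X → Bool} {ltY eqY : Y → Y → Bool}
  (P : X → Set) (t : X → Y)
  (lt-t : ∀ {x y} → P x → P y → ltY (t x) (t y) ≡ ltX x y)
  (eq-t : ∀ {x y} → P x → P y → eqY (t x) (t y) ≡ eqX x y) where

  nubB-map : ∀ {xs} → All P xs → nubB eqY (map t xs) ≡ map t (nubB eqX xs)
  nubB-map [] = refl
  nubB-map {x ∷ xs} (px ∷ pxs) = cong (t x ∷_) (begin
    filterᵇ (not ∘ eqY (t x)) (nubB eqY (map t xs)) ≡⟨ cong (filterᵇ _) (nubB-map pxs) ⟩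
    filterᵇ (not ∘ eqY (t x)) (map t (nubB eqX xs)) ≡⟨ filterᵇ-map t (All.map (cong not ∘ eq-t px) (All-nubB eqX pxs)) ⟩
    map t (filterᵇ (not ∘ eqX x) (nubB eqX xs))     ∎)
    where open ≡-Reasoning

  countBelow-map : ∀ {x xs} → P x → All P xs → countBelow ltY eqY (t x) (map t xs) ≡ countBelow ltX eqX x xs
  countBelow-map {x} {xs} px pxs = begin
    length (nubB eqY (filterᵇ (λ y → ltY y (t x)) (map t xs))) ≡⟨ cong (length ∘ nubB eqY) (filterᵇ-map t (All.map (λ py → lt-t py px) pxs)) ⟩
    length (nubB eqY (map t (filterᵇ (λ y → ltX y x) xs)))     ≡⟨ cong length (nubB-map (Allₚ.filter⁺ _ pxs)) ⟩
    length (map t (nubB eqX (filterᵇ (λ y → ltX y x) xs)))     ≡⟨ length-map t (nubB eqX (filterᵇ (λ y → ltX y x) xs)) ⟩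
    length (nubB eqX (filterᵇ (λ y → ltX y x) xs))             ∎
    where open ≡-Reasoning

  ranks-map : ∀ {xs} → All P xs → ranks ltY eqY (map t xs) ≡ ranks ltX eqX xs
  ranks-map {xs} pxs = trans (sym (map-∘ xs)) (map-cong-local (All.map (λ px → countBelow-map px pxs) pxs))

countBelow-complete : ∀ z xs → (∀ k → k < z → k ∈ xs) → countBelow ISℕ.ltA ISℕ.eqA z xs ≡ z
countBelow-complete z xs below = begin
  length (nubB eqA (filterᵇ (λ y → ltA y z) xs)) ≡⟨ ↭-length (∼bag⇒↭ (unique∧set⇒bag (nubB-unique _) (Uniqueₚ.upTo⁺ z) (mk⇔ to from))) ⟩
  length (upTo z)                                ≡⟨ length-upTo z ⟩
  z                                              ∎
  where
  open ≡-Reasoning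
  open ISℕ using (ltA; eqA)
  open BooleanComparisons <-isStrictTotalOrder
  open Deduplication eqA eqA-reflects
  to : ∀ {k} → k ∈ nubB eqA (filterᵇ (λ y → ltA y z) xs) → k ∈ upTo z
  to {k} k∈ = ∈-upTo⁺ (T⇒reflects (ltA-reflects k z) (proj₂ (∈-filter⁻ (T? ∘ λ y → ltA y z) {xs = xs} (∈-nubB⁻ _ k∈))))
  from : ∀ {k} → k ∈ upTo z → k ∈ nubB eqA (filterᵇ (λ y → ltA y z) xs)
  from {k} k∈ = ∈-nubB⁺ _ (∈-filter⁺ (T? ∘ λ y → ltA y z) (below k k<z) (reflects⇒T (ltA-reflects k z) k<z))
    where
    k<z : k < z
    k<z = ∈-upTo⁻ k∈

-- Changing the alphabet

mapExt : ∀ {B A : Set} → (B → A) → Ext B → Ext A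
mapExt g $ = $
mapExt g ⟨ x ⟩ = ⟨ g x ⟩

module AlphabetChange
  {B : Set} {_<_ : Rel B 0ℓ} (stoB : IsStrictTotalOrder _≡_ _<_)
  {A : Set} {_≺_ : Rel A 0ℓ} (stoA : IsStrictTotalOrder _≡_ _≺_)
  (P : B → Set) (g : B → A) (g-mono : ∀ {x y} → P x → P y → x < y → g x ≺ g y) where

  private
    module Src = IS stoB
    module Tgt = IS stoA
    module SrcTests = BooleanComparisons stoB
    module TgtTests = BooleanComparisons stoA
  open IsStrictTotalOrder stoB using (compare)
  open IsStrictTotalOrder stoA using (irrefl; asym)

  g-reflects-< : ∀ {x y} → P x → P y → g x ≺ g y → x < y
  g-reflects-< {x} {y} px py gx≺gy with compare x y
  ... | tri< x<y _ _ = x<y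
  ... | tri≈ _ refl _ = ⊥-elim (irrefl refl gx≺gy)
  ... | tri> _ _ y<x = ⊥-elim (asym gx≺gy (g-mono py px y<x))

  g-injective : ∀ {x y} → P x → P y → g x ≡ g y → x ≡ y
  g-injective {x} {y} px py gx≡gy with compare x y
  ... | tri< x<y _ _ = ⊥-elim (irrefl gx≡gy (g-mono px py x<y))
  ... | tri≈ _ x≡y _ = x≡y
  ... | tri> _ _ y<x = ⊥-elim (irrefl (sym gx≡gy) (g-mono py px y<x))

  ltA-map : ∀ {x y} → P x → P y → Tgt.ltA (g x) (g y) ≡ Src.ltA x y
  ltA-map {x} {y} px py = det (TgtTests.ltA-reflects (g x) (g y))
    (reflects-⇔ (g-mono px py) (g-reflects-< px py) (SrcTests.ltA-reflects x y))

  eqA-map : ∀ {x y} → P x → P y → Tgt.eqA (g x) (g y) ≡ Src.eqA x y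
  eqA-map {x} {y} px py = det (TgtTests.eqA-reflects (g x) (g y))
    (reflects-⇔ (cong g) (g-injective px py) (SrcTests.eqA-reflects x y))

  P$ : Ext B → Set
  P$ $ = ⊤
  P$ ⟨ x ⟩ = P x

  ltE-map : ∀ e e' → P$ e → P$ e' → Tgt.ltE (mapExt g e) (mapExt g e') ≡ Src.ltE e e'
  ltE-map $ $ _ _ = refl
  ltE-map $ ⟨ _ ⟩ _ _ = refl
  ltE-map ⟨ _ ⟩ $ _ _ = refl
  ltE-map ⟨ _ ⟩ ⟨ _ ⟩ px py = ltA-map px py

  eqE-map : ∀ e e' → P$ e → P$ e' → Tgt.eqE (mapExt g e) (mapExt g e') ≡ Src.eqE e e'
  eqE-map $ $ _ _ = refl
  eqE-map $ ⟨ _ ⟩ _ _ = refl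
  eqE-map ⟨ _ ⟩ $ _ _ = refl
  eqE-map ⟨ _ ⟩ ⟨ _ ⟩ px py = eqA-map px py

  lexLt-map : ∀ {s t} → All P$ s → All P$ t → Tgt.lexLt (map (mapExt g) s) (map (mapExt g) t) ≡ Src.lexLt s t
  lexLt-map [] [] = refl
  lexLt-map [] (_ ∷ _) = refl
  lexLt-map (_ ∷ _) [] = refl
  lexLt-map {x ∷ _} {y ∷ _} (px ∷ ps) (py ∷ pt) = cong₂ _∨_ (ltE-map x y px py) (cong₂ _∧_ (eqE-map x y px py) (lexLt-map ps pt))

  lexEq-map : ∀ {s t} → All P$ s → All P$ t → Tgt.lexEq (map (mapExt g) s) (map (mapExt g) t) ≡ Src.lexEq s t
  lexEq-map [] [] = refl
  lexEq-map [] (_ ∷ _) = refl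
  lexEq-map (_ ∷ _) [] = refl
  lexEq-map {x ∷ _} {y ∷ _} (px ∷ ps) (py ∷ pt) = cong₂ _∧_ (eqE-map x y px py) (lexEq-map ps pt)

  at-map : ∀ u i → Tgt.at (map g u) i ≡ mapExt g (Src.at u i)
  at-map [] i = refl
  at-map (x ∷ u) zero = refl
  at-map (x ∷ u) (suc i) = at-map u i

  module _ {u : List B} (pu : All P u) where

    P$-at : ∀ i → P$ (Src.at u i)
    P$-at = go pu
      where
      go : ∀ {u} → All P u → ∀ i → P$ (Src.at u i)
      go [] i = tt
      go (px ∷ _) zero = px
      go (_ ∷ pu) (suc i) = go pu i

    ltE-at : ∀ m i → Tgt.ltE (Tgt.at (map g u) m) (Tgt.at (map g u) i) ≡ Src.ltE (Src.at u m) (Src.at u i)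
    ltE-at m i rewrite at-map u m | at-map u i = ltE-map (Src.at u m) (Src.at u i) (P$-at m) (P$-at i)

    eqE-at : ∀ m i → Tgt.eqE (Tgt.at (map g u) m) (Tgt.at (map g u) i) ≡ Src.eqE (Src.at u m) (Src.at u i)
    eqE-at m i rewrite at-map u m | at-map u i = eqE-map (Src.at u m) (Src.at u i) (P$-at m) (P$-at i)

    nonDecreasing-map : ∀ i → Tgt.nonDecreasing (map g u) i ≡ Src.nonDecreasing u i
    nonDecreasing-map i rewrite length-map g u =
      cong or (map-cong (λ j → cong₂ _∧_ (cong and (map-cong (λ m → eqE-at m i) (range i (j ∸ 1)))) (ltE-at (j ∸ 1) j)) (range (suc i) (length u ∸ 1)))

    locallyMinimal-map : ∀ i → Tgt.locallyMinimal (map g u) i ≡ Src.locallyMinimal u i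
    locallyMinimal-map zero = refl
    locallyMinimal-map (suc i) = cong₂ _∧_ (nonDecreasing-map (suc i)) (ltE-at (suc i) i)

    boundaries-map : Tgt.boundaries (map g u) ≡ Src.boundaries u
    boundaries-map rewrite length-map g u = cong (_++ [ length u ]) (filterᵇ-cong locallyMinimal-map (upTo (length u)))

    factor-map : ∀ i j → Tgt.factor (map g u) i j ≡ map (mapExt g) (Src.factor u i j)
    factor-map i j = trans (map-cong (at-map u) (range i j)) (map-∘ (range i j))

    eis-map : Tgt.eis (map g u) ≡ map (map (mapExt g)) (Src.eis u)
    eis-map rewrite boundaries-map = begin
      zipWith (Tgt.factor (map g u)) bs (drop 1 bs)                 ≡⟨ zipWith-cong factor-map bs (drop 1 bs) ⟩
      zipWith (λ i j → map (mapExt g) (Src.factor u i j)) bs (drop 1 bs) ≡⟨ map-zipWith (Src.factor u) (map (mapExt g)) bs (drop 1 bs) ⟨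
      map (map (mapExt g)) (zipWith (Src.factor u) bs (drop 1 bs))  ∎
      where
      open ≡-Reasoning
      bs : List ℕ
      bs = Src.boundaries u

    P$-eis : All (All P$) (Src.eis u)
    P$-eis = go (Src.boundaries u) (drop 1 (Src.boundaries u))
      where
      go : ∀ is js → All (All P$) (zipWith (Src.factor u) is js)
      go [] _ = []
      go (_ ∷ _) [] = []
      go (i ∷ is) (j ∷ js) = Allₚ.map⁺ (All.tabulate (λ {k} _ → P$-at k)) ∷ go is js

    is-map : Tgt.is (map g u) ≡ Src.is u
    is-map rewrite eis-map = RankInvariance.ranks-map (All P$) (map (mapExt g)) (λ {s} {t} → lexLt-map {s} {t}) (λ {s} {t} → lexEq-map {s} {t}) P$-eis

module _ {A : Set} {_≺_ : Rel A 0ℓ} (sto : IsStrictTotalOrder _≡_ _≺_) where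
  open IsStrictTotalOrder sto using () renaming (trans to ≺-trans)

  adjacent⇒increasing : ∀ {g : ℕ → A} {n} → (∀ {i} → i < n → g i ≺ g (suc i)) →
                        ∀ {x y} → x < y → y ≤ n → g x ≺ g y
  adjacent⇒increasing step {x = x} {suc y} (s≤s x≤y) y<n with m≤n⇒m<n∨m≡n x≤y
  ... | inj₁ x<y = ≺-trans (adjacent⇒increasing step x<y (≤-trans (n≤1+n y) y<n)) (step y<n)
  ... | inj₂ refl = step y<n

  strictTotalOrder : StrictTotalOrder 0ℓ 0ℓ 0ℓ
  strictTotalOrder = record { isStrictTotalOrder = sto }

  module _ (f : Fin 4 → A) (f-injective : Injective _≡_ _≡_ f) where
    open StrictTotalOrderProperties strictTotalOrder using (decTotalOrder)
    open Sort decTotalOrder using (sort; sort-↭; sort-↗)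

    sorted : List A
    sorted = sort (tabulate f)

    sorted-unique : Unique sorted
    sorted-unique = Permₚ.Unique-resp-↭ (setoid A) (↭⇒↭ₛ (↭-sym (sort-↭ (tabulate f)))) (Uniqueₚ.tabulate⁺ f-injective)

    sorted-length : length sorted ≡ 4
    sorted-length = ↭-length (sort-↭ (tabulate f))

    strictly-sorted : ∀ {xs} → Linked (λ x y → x ≺ y ⊎ x ≡ y) xs → Unique xs → Linked _≺_ xs
    strictly-sorted [] _ = []
    strictly-sorted [-] _ = [-]
    strictly-sorted (inj₁ x≺y ∷ l) (_ ∷ u) = x≺y ∷ strictly-sorted l u
    strictly-sorted (inj₂ x≡y ∷ l) ((x≢y ∷ _) ∷ _) = ⊥-elim (x≢y x≡y)

    increasing-letters : Σ (ℕ → A) λ g → ∀ {x y} → x < y → y ≤ 3 → g x ≺ g y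
    increasing-letters = letters sorted (strictly-sorted (sort-↗ (tabulate f)) sorted-unique) sorted-length
      where
      letters : ∀ xs → Linked _≺_ xs → length xs ≡ 4 → Σ (ℕ → A) λ g → ∀ {x y} → x < y → y ≤ 3 → g x ≺ g y
      letters (a ∷ b ∷ c ∷ d ∷ []) (a≺b ∷ b≺c ∷ c≺d ∷ [-]) _ = g , adjacent⇒increasing step
        where
        g : ℕ → A
        g 0 = a
        g 1 = b
        g 2 = c
        g _ = d
        step : ∀ {i} → i < 3 → g i ≺ g (suc i)
        step {0} _ = a≺b
        step {1} _ = b≺c
        step {2} _ = c≺d
        step {suc (suc (suc _))} (s≤s (s≤s (s≤s ())))
      letters [] _ ()
      letters (_ ∷ []) _ ()
      letters (_ ∷ _ ∷ []) _ ()
      letters (_ ∷ _ ∷ _ ∷ []) _ ()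
      letters (_ ∷ _ ∷ _ ∷ _ ∷ _ ∷ _) _ ()

-- The doubling construction

open ISℕ
open BooleanComparisons <-isStrictTotalOrder

low : ℕ → ℕ
low 0 = 0
low 1 = 0
low _ = 1

low≤1 : ∀ z → low z ≤ 1
low≤1 0 = z≤n
low≤1 1 = z≤n
low≤1 (suc (suc _)) = s≤s z≤n

pairs : (ℕ → ℕ) → List ℕ → List ℕ
pairs β [] = []
pairs β (z ∷ zs) = low z ∷ β z ∷ pairs β zs

-- The leading 2 makes position 1 locally minimal; letters before the first locally
-- minimal position belong to no unimodal factor.
double : (ℕ → ℕ) → List ℕ → List ℕ
double β X = 2 ∷ pairs β X

length-pairs : ∀ β X → length (pairs β X) ≡ length X + length X
length-pairs β [] = refl
length-pairs β (z ∷ zs) = cong suc (trans (cong suc (length-pairs β zs)) (sym (+-suc (length zs) (length zs))))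

at-pairs-even : ∀ β X i → at (pairs β X) (i + i) ≡ mapExt low (at X i)
at-pairs-even β [] zero = refl
at-pairs-even β [] (suc i) = refl
at-pairs-even β (z ∷ zs) zero = refl
at-pairs-even β (z ∷ zs) (suc i) rewrite +-suc i i = at-pairs-even β zs i

at-pairs-odd : ∀ β X i → at (pairs β X) (suc (i + i)) ≡ mapExt β (at X i)
at-pairs-odd β [] zero = refl
at-pairs-odd β [] (suc i) = refl
at-pairs-odd β (z ∷ zs) zero = refl
at-pairs-odd β (z ∷ zs) (suc i) rewrite +-suc i i = at-pairs-odd β zs i

at-defined : ∀ X {i} → i < length X → Σ ℕ λ x → at X i ≡ ⟨ x ⟩
at-defined (x ∷ X) {zero} _ = x , refl
at-defined (x ∷ X) {suc i} (s≤s i<n) = at-defined X i<n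

triple : (ℕ → ℕ) → List ℕ → ℕ → List (Ext ℕ)
triple β X i = mapExt low (at X i) ∷ mapExt β (at X i) ∷ mapExt low (at X (suc i)) ∷ []

module DoubleStructure (β : ℕ → ℕ) (2≤β : ∀ z → 2 ≤ β z) (X : List ℕ) where

  Y : List ℕ
  Y = double β X

  N : ℕ
  N = length X

  low<β : ∀ x y → ltA (low x) (β y) ≡ true
  low<β x y = det (ltA-reflects (low x) (β y)) (ofʸ (≤-trans (s≤s (low≤1 x)) (2≤β y)))

  β≮low : ∀ e → ltE (mapExt β e) (mapExt low e) ≡ false
  β≮low $ = refl
  β≮low ⟨ x ⟩ = det (ltA-reflects (β x) (low x)) (ofⁿ (<⇒≯ (≤-trans (s≤s (low≤1 x)) (2≤β x))))

  2+2i≤length : ∀ {i} → i < N → suc (suc (i + i)) ≤ length (pairs β X)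
  2+2i≤length i<N = subst (_ ≤_) (sym (length-pairs β X)) (≤-trans (≤-reflexive (cong suc (sym (+-suc _ _)))) (+-mono-≤ i<N i<N))

  nonDecreasing-odd : ∀ i → i < N → nonDecreasing Y (suc (i + i)) ≡ true
  nonDecreasing-odd i i<N with at-defined X i<N
  ... | x , Xi≡x
    rewrite range-cons {suc (suc (i + i))} {length (pairs β X)} (2+2i≤length i<N)
          | range-cons (≤-refl {suc (i + i)}) | range-empty (n<1+n (suc (i + i)))
          | at-pairs-even β X i | at-pairs-odd β X i | Xi≡x
          | det (eqA-reflects (low x) (low x)) (ofʸ refl) | low<β x x = refl

  locallyMinimal-odd : ∀ i → i < N → locallyMinimal Y (suc (i + i)) ≡ true
  locallyMinimal-odd zero 0<N with at-defined X 0<N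
  ... | x , X0≡x rewrite nonDecreasing-odd zero 0<N | at-pairs-even β X 0 | X0≡x = det (ltA-reflects (low x) 2) (ofʸ (s≤s (low≤1 x)))
  locallyMinimal-odd (suc i) i<N with at-defined X i<N | at-defined X (<⇒≤ i<N)
  ... | x , Xi≡x | y , Xi-1≡y
    rewrite nonDecreasing-odd (suc i) i<N | at-pairs-even β X (suc i) | +-suc i i | at-pairs-odd β X i
          | Xi≡x | Xi-1≡y = low<β x y

  locallyMinimal-even : ∀ i → locallyMinimal Y (suc (suc (i + i))) ≡ false
  locallyMinimal-even i rewrite at-pairs-odd β X i | at-pairs-even β X i | β≮low (at X i) = ∧-zeroʳ _

  boundaries-double : boundaries Y ≡ applyUpTo (λ i → suc (i + i)) (suc N)
  boundaries-double = begin
    filterᵇ (locallyMinimal Y) (upTo (suc (length (pairs β X)))) ++ [ suc (length (pairs β X)) ]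
      ≡⟨ cong (λ n → filterᵇ (locallyMinimal Y) (upTo (suc n)) ++ [ suc n ]) (length-pairs β X) ⟩
    filterᵇ (locallyMinimal Y) (upTo (suc (N + N))) ++ [ suc (N + N) ]
      ≡⟨ cong (_++ [ suc (N + N) ]) (filterᵇ-applyUpTo-odd (locallyMinimal Y) (λ k → k) N locallyMinimal-odd even) ⟩
    applyUpTo (λ i → suc (i + i)) N ++ [ suc (N + N) ]
      ≡⟨ applyUpTo-∷ʳ (λ i → suc (i + i)) N ⟩
    applyUpTo (λ i → suc (i + i)) (suc N) ∎
    where
    open ≡-Reasoning
    even : ∀ i → i ≤ N → locallyMinimal Y (i + i) ≡ false
    even zero _ = refl
    even (suc i) _ rewrite +-suc i i = locallyMinimal-even i

  factor-odd : ∀ i → factor Y (suc (i + i)) (suc (suc i + suc i)) ≡ triple β X i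
  factor-odd i rewrite +-suc i i
    | range-cons (m≤n⇒m≤1+n (m≤n⇒m≤1+n (≤-refl {suc (i + i)})))
    | range-cons (m≤n⇒m≤1+n (≤-refl {suc (suc (i + i))}))
    | range-cons (≤-refl {suc (suc (suc (i + i)))})
    | range-empty (n<1+n (suc (suc (suc (i + i)))))
    | at-pairs-even β X i | at-pairs-odd β X i | sym (+-suc i i) | at-pairs-even β X (suc i) = refl

  eis-double : eis Y ≡ applyUpTo (triple β X) N
  eis-double rewrite boundaries-double =
    trans (zipWith-applyUpTo-suc (factor Y) (λ i → suc (i + i)) N) (applyUpTo-cong factor-odd N)

-- In an alternating word a letter 0 or 1 is followed by a letter of low value 1, a
-- letter 2 or 4 by one of low value 0, and 3 comes last; so τ β z is the unimodal
-- factor contributed by the letter z.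
next : ℕ → Ext ℕ
next 0 = ⟨ 1 ⟩
next 1 = ⟨ 1 ⟩
next 3 = $
next _ = ⟨ 0 ⟩

τ : (ℕ → ℕ) → ℕ → List (Ext ℕ)
τ β z = ⟨ low z ⟩ ∷ ⟨ β z ⟩ ∷ next z ∷ []

data High : ℕ → Set where
  high-2 : High 2
  high-4 : High 4

data Low : ℕ → Set where
  low-0 : Low 0
  low-1 : Low 1

data Alternating : List ℕ → Set where
  end  : Alternating (3 ∷ [])
  cons : ∀ {p m xs} → High p → Low m → Alternating xs → Alternating (p ∷ m ∷ xs)

Alternating⇒≤4 : ∀ {X} → Alternating X → All (_≤ 4) X
Alternating⇒≤4 end = s≤s (s≤s (s≤s z≤n)) ∷ []
Alternating⇒≤4 (cons hp lm a) = high≤4 hp ∷ low≤4 lm ∷ Alternating⇒≤4 a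
  where
  high≤4 : ∀ {p} → High p → p ≤ 4
  high≤4 high-2 = s≤s (s≤s z≤n)
  high≤4 high-4 = ≤-refl
  low≤4 : ∀ {m} → Low m → m ≤ 4
  low≤4 low-0 = z≤n
  low≤4 low-1 = s≤s z≤n

triples-Alternating : ∀ β {X} → Alternating X → applyUpTo (triple β X) (length X) ≡ map (τ β) X
triples-Alternating β end = refl
triples-Alternating β (cons {p} {m} {xs} hp lm a) =
  cong₂ _∷_ (high-triple hp lm) (cong₂ _∷_ (low-triple lm) (triples-Alternating β a))
  where
  high-triple : High p → Low m → triple β (p ∷ m ∷ xs) 0 ≡ τ β p
  high-triple high-2 low-0 = refl
  high-triple high-2 low-1 = refl
  high-triple high-4 low-0 = refl
  high-triple high-4 low-1 = refl
  low-after-low : ∀ {ys} → Alternating ys → mapExt low (at ys 0) ≡ ⟨ 1 ⟩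
  low-after-low end = refl
  low-after-low (cons high-2 _ _) = refl
  low-after-low (cons high-4 _ _) = refl
  low-triple : Low m → triple β (m ∷ xs) 0 ≡ τ β m
  low-triple low-0 rewrite low-after-low a = refl
  low-triple low-1 rewrite low-after-low a = refl

TauAgrees : (ℕ → ℕ) → ℕ → ℕ → Set
TauAgrees β y z = lexLt (τ β y) (τ β z) ≡ ltA y z × lexEq (τ β y) (τ β z) ≡ eqA y z

TauEmbeds : (ℕ → ℕ) → Set
TauEmbeds β = ∀ {y z} → y ≤ 4 → z ≤ 4 → TauAgrees β y z

is-double : ∀ β → (∀ z → 2 ≤ β z) → TauEmbeds β → ∀ {X} → Alternating X → is (double β X) ≡ ranks ltA eqA X
is-double β 2≤β embeds {X} a rewrite DoubleStructure.eis-double β 2≤β X | triples-Alternating β a =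
  RankInvariance.ranks-map (_≤ 4) (τ β) (λ y≤4 z≤4 → proj₁ (embeds y≤4 z≤4)) (λ y≤4 z≤4 → proj₂ (embeds y≤4 z≤4)) (Alternating⇒≤4 a)

≤4-table : ∀ {Q : ℕ → ℕ → Set} → All (λ y → All (Q y) (upTo 5)) (upTo 5) → ∀ {y z} → y ≤ 4 → z ≤ 4 → Q y z
≤4-table table y≤4 z≤4 = All.lookup (All.lookup table (∈-upTo⁺ (s≤s y≤4))) (∈-upTo⁺ (s≤s z≤4))

TauAgrees? : ∀ β y z → Dec (TauAgrees β y z)
TauAgrees? β y z = (lexLt (τ β y) (τ β z) Bool.≟ ltA y z) ×-dec (lexEq (τ β y) (τ β z) Bool.≟ eqA y z)

TauTable? : ∀ β → Dec (All (λ y → All (TauAgrees β y) (upTo 5)) (upTo 5))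
TauTable? β = All.all? (λ y → All.all? (TauAgrees? β y) (upTo 5)) (upTo 5)

βinner : ℕ → ℕ
βinner 0 = 2
βinner 1 = 4
βinner 2 = 2
βinner 3 = 3
βinner _ = 4

-- Unlike βinner, βtop avoids the letter 4, so the top word is over 0–3.
βtop : ℕ → ℕ
βtop 0 = 2
βtop 1 = 3
βtop 2 = 2
βtop _ = 3

βinner≥2 : ∀ z → 2 ≤ βinner z
βinner≥2 0 = ≤-refl
βinner≥2 1 = s≤s (s≤s z≤n)
βinner≥2 2 = ≤-refl
βinner≥2 3 = s≤s (s≤s z≤n)
βinner≥2 (suc (suc (suc (suc _)))) = s≤s (s≤s z≤n)

βtop≥2 : ∀ z → 2 ≤ βtop z
βtop≥2 0 = ≤-refl
βtop≥2 1 = s≤s (s≤s z≤n)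
βtop≥2 2 = ≤-refl
βtop≥2 (suc (suc (suc _))) = s≤s (s≤s z≤n)

βinner-embeds : TauEmbeds βinner
βinner-embeds = ≤4-table (from-yes (TauTable? βinner))

βtop-embeds : TauEmbeds βtop
βtop-embeds = ≤4-table (from-yes (TauTable? βtop))

-- The tower

tower : ℕ → List ℕ
tower 0 = 2 ∷ 2 ∷ 3 ∷ []
tower (suc k) = double βinner (tower k)

ranked : ℕ → List ℕ
ranked k = ranks ltA eqA (tower k)

pairs-Alternating : ∀ {b X} → High b → Alternating X → Alternating (b ∷ pairs βinner X)
pairs-Alternating hb end = cons hb low-1 end
pairs-Alternating hb (cons high-2 low-0 a) = cons hb low-1 (cons high-2 low-0 (pairs-Alternating high-2 a))
pairs-Alternating hb (cons high-2 low-1 a) = cons hb low-1 (cons high-2 low-0 (pairs-Alternating high-4 a))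
pairs-Alternating hb (cons high-4 low-0 a) = cons hb low-1 (cons high-4 low-0 (pairs-Alternating high-2 a))
pairs-Alternating hb (cons high-4 low-1 a) = cons hb low-1 (cons high-4 low-0 (pairs-Alternating high-4 a))

tower-Alternating : ∀ k → Alternating (tower (suc k))
tower-Alternating zero = cons high-2 low-1 (cons high-2 low-1 (cons high-2 low-1 end))
tower-Alternating (suc k) = pairs-Alternating high-2 (tower-Alternating k)

low-∈-pairs : ∀ β {z X} → z ∈ X → low z ∈ pairs β X
low-∈-pairs β (here refl) = here refl
low-∈-pairs β {X = _ ∷ _} (there z∈X) = there (there (low-∈-pairs β z∈X))

3∈Alternating : ∀ {X} → Alternating X → 3 ∈ X
3∈Alternating end = here refl
3∈Alternating (cons _ _ a) = there (there (3∈Alternating a))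

2∈tower : ∀ k → 2 ∈ tower k
2∈tower zero = here refl
2∈tower (suc k) = here refl

1∈tower : ∀ k → 1 ∈ tower (suc k)
1∈tower k = there (low-∈-pairs βinner (2∈tower k))

ranks-self : ∀ {X} → All (λ z → ∀ k → k < z → k ∈ X) X → ranks ltA eqA X ≡ X
ranks-self {X} below = map-id-local (All.map (λ {z} → countBelow-complete z X) below)

ranks-tower : ∀ k → ranks ltA eqA (tower (suc (suc k))) ≡ tower (suc (suc k))
ranks-tower k = ranks-self (All.map below (Alternating⇒≤4 (tower-Alternating (suc k))))
  where
  below : ∀ {z} → z ≤ 4 → ∀ j → j < z → j ∈ tower (suc (suc k))
  below _ 0 _ = there (low-∈-pairs βinner (1∈tower k))
  below _ 1 _ = 1∈tower (suc k)
  below _ 2 _ = 2∈tower (suc (suc k))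
  below _ 3 _ = 3∈Alternating (tower-Alternating (suc k))
  below z≤4 (suc (suc (suc (suc j)))) j<z with ≤-trans j<z z≤4
  ... | s≤s (s≤s (s≤s (s≤s ())))

length-double : ∀ β X → length (double β X) + 1 ≡ 2 * (length X + 1)
length-double β X = trans (cong (λ n → suc n + 1) (length-pairs β X)) (arith (length X))
  where
  arith : ∀ n → suc (n + n) + 1 ≡ 2 * (n + 1)
  arith = solve-∀

length-tower : ∀ k → length (tower k) + 1 ≡ 2 ^ (2 + k)
length-tower zero = refl
length-tower (suc k) = trans (length-double βinner (tower k)) (cong (2 *_) (length-tower k))

-- tower 0 starts with 2 2 and tower (suc k) with 2 1 2.
¬Unique-ranked : ∀ k → ¬ Unique (ranked k)
¬Unique-ranked zero ((r₀≢r₁ ∷ _) ∷ _) = r₀≢r₁ refl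
¬Unique-ranked (suc zero) ((_ ∷ r₀≢r₂ ∷ _) ∷ _) = r₀≢r₂ refl
¬Unique-ranked (suc (suc k)) ((_ ∷ r₀≢r₂ ∷ _) ∷ _) = r₀≢r₂ refl

is-ranked : ∀ k → is (ranked (suc k)) ≡ ranked k
is-ranked zero = refl
is-ranked (suc k) = begin
  is (ranks ltA eqA (tower (suc (suc k)))) ≡⟨ cong is (ranks-tower k) ⟩
  is (double βinner (tower (suc k)))       ≡⟨ is-double βinner βinner≥2 βinner-embeds (tower-Alternating k) ⟩
  ranked (suc k)                           ∎
  where open ≡-Reasoning

is-top : ∀ k → is (double βtop (tower k)) ≡ ranked k
is-top zero = refl
is-top (suc k) = is-double βtop βtop≥2 βtop-embeds (tower-Alternating k)

is-ranked-0 : is (ranked 0) ≡ []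
is-ranked-0 = refl

double-βtop-≤3 : ∀ X → All (_≤ 3) (double βtop X)
double-βtop-≤3 X = s≤s (s≤s z≤n) ∷ pairs-≤3 X
  where
  βtop≤3 : ∀ z → βtop z ≤ 3
  βtop≤3 0 = s≤s (s≤s z≤n)
  βtop≤3 1 = ≤-refl
  βtop≤3 2 = s≤s (s≤s z≤n)
  βtop≤3 (suc (suc (suc _))) = ≤-refl
  pairs-≤3 : ∀ X → All (_≤ 3) (pairs βtop X)
  pairs-≤3 [] = []
  pairs-≤3 (z ∷ zs) = ≤-trans (low≤1 z) (s≤s z≤n) ∷ βtop≤3 z ∷ pairs-≤3 zs

module Construction {A : Set} {_≺_ : Rel A 0ℓ} (sto : IsStrictTotalOrder _≡_ _≺_)
  (g : ℕ → A) (g-increasing : ∀ {x y} → x < y → y ≤ 3 → g x ≺ g y) where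

  word : ℕ → List A
  word k = map g (double βtop (tower k))

  is-word : ∀ k → IS.is sto (word k) ≡ ranked k
  is-word k = trans (AlphabetChange.is-map <-isStrictTotalOrder sto (_≤ 3) g (λ _ y≤3 x<y → g-increasing x<y y≤3) (double-βtop-≤3 (tower k)))
                    (is-top k)

  is^-word : ∀ i k → is^suc sto k (word (i + k)) ≡ ranked i
  is^-word i zero rewrite +-identityʳ i = is-word i
  is^-word i (suc k) rewrite +-suc i k = trans (cong is (is^-word (suc i) k)) (is-ranked i)

  is^-word-≤ : ∀ {m k} → k ≤ m → is^suc sto k (word m) ≡ ranked (m ∸ k)
  is^-word-≤ {m} {k} k≤m = subst (λ n → is^suc sto k (word n) ≡ ranked (m ∸ k)) (m∸n+n≡m k≤m) (is^-word (m ∸ k) k)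

  length-word : ∀ k → length (word k) + 1 ≡ 2 ^ (3 + k)
  length-word k = begin
    length (word k) + 1                     ≡⟨ cong (_+ 1) (length-map g (double βtop (tower k))) ⟩
    length (double βtop (tower k)) + 1      ≡⟨ length-double βtop (tower k) ⟩
    2 * (length (tower k) + 1)              ≡⟨ cong (2 *_) (length-tower k) ⟩
    2 ^ (3 + k)                             ∎
    where open ≡-Reasoning

  length-is^-word : ∀ {m k} → k ≤ m → (len-is^ sto (suc k) (word m) + 1) * 2 ^ suc k ≡ length (word m) + 1
  length-is^-word {m} {k} k≤m = begin
    (length (is^suc sto k (word m)) + 1) * 2 ^ suc k   ≡⟨ cong (λ v → (length v + 1) * 2 ^ suc k) (is^-word-≤ k≤m) ⟩
    (length (ranked (m ∸ k)) + 1) * 2 ^ suc k         ≡⟨ cong (λ n → (n + 1) * 2 ^ suc k) (length-map _ (tower (m ∸ k))) ⟩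
    (length (tower (m ∸ k)) + 1) * 2 ^ suc k          ≡⟨ cong (_* 2 ^ suc k) (length-tower (m ∸ k)) ⟩
    2 ^ (2 + (m ∸ k)) * 2 ^ suc k                     ≡⟨ ^-distribˡ-+-* 2 (2 + (m ∸ k)) (suc k) ⟨
    2 ^ (2 + (m ∸ k) + suc k)                         ≡⟨ cong (λ n → 2 ^ suc (suc n)) (trans (+-suc (m ∸ k) k) (cong suc (m∸n+n≡m k≤m))) ⟩
    2 ^ (3 + m)                                       ≡⟨ length-word m ⟨
    length (word m) + 1                               ∎
    where open ≡-Reasoning

theorem4 : {A : Set} {_≺_ : Rel A 0ℓ} (sto : IsStrictTotalOrder _≡_ _≺_)
    → (f : Fin 4 → A) → Injective _≡_ _≡_ f
    → (n : ℕ) → 3 ≤ n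
    → Σ (List A) (λ w → (length w ≡ 2 ^ n ∸ 1)
        × PerformsRecursiveCalls sto w (n ∸ 2)
        × (∀ k → k ≤ n ∸ 2 → (len-is^ sto k w + 1) * 2 ^ k ≡ length w + 1))
theorem4 sto f f-injective (suc (suc (suc m))) _ with increasing-letters sto f f-injective
... | g , g-increasing = word m , length≡ , (repeated , distinct) , lengths
  where
  open Construction sto g g-increasing
  length≡ : length (word m) ≡ 2 ^ (3 + m) ∸ 1
  length≡ = trans (sym (m+n∸n≡m (length (word m)) 1)) (cong (_∸ 1) (length-word m))
  repeated : ∀ k → k < suc m → ¬ Unique (is^suc sto k (word m))
  repeated k (s≤s k≤m) = ¬Unique-ranked (m ∸ k) ∘ subst Unique (is^-word-≤ k≤m)
  distinct : Unique (is^suc sto (suc m) (word m))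
  distinct = subst Unique (sym (trans (cong is (is^-word 0 m)) is-ranked-0)) []
  lengths : ∀ k → k ≤ suc m → (len-is^ sto k (word m) + 1) * 2 ^ k ≡ length (word m) + 1
  lengths zero _ = *-identityʳ _
  lengths (suc k) (s≤s k≤m) = length-is^-word k≤m
theorem4 _ _ _ zero ()
theorem4 _ _ _ (suc zero) (s≤s ())
theorem4 _ _ _ (suc (suc zero)) (s≤s (s≤s ()))
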